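{- Let $\Gamma$ be a digraph, let $N$ be a maximum-cardinality even factor in $\Gamma$, and let $\mathcal{T}$ be a feasible alternating forest for $N$. If $v$ is a node of $\Gamma$ such that $v^1$ is $\mathcal{T}$-reachable, then $\mathrm{def}(\Gamma \ast v) = \mathrm{def}(\Gamma)$, where $\Gamma \ast v$ is obtained from $\Gamma$ by adding a new node $v'$ and a single arc $(v,v')$.
   Context: Digraphs may have parallel arcs but no loops. A path or cycle is even (odd) if it has an even (odd) number of arcs. A path-cycle matching of a digraph $H$ is an arc set that is a union of node-disjoint simple paths and simple cycles; it is an even factor if it contains no odd cycle. For an even factor $M$, $\mathrm{def}(H,M) = |VH| - |M|$ and $\mathrm{def}(H) = \min_M \mathrm{def}(H,M)$ over even factors $M$ of $H$. Auxiliary digraph: take two disjoint copies $V^1 = \{u^1 : u \in VH\}$ and $V^2 = \{u^2 : u \in VH\}$ of $VH$; for each arc $a=(u,v)$ of $H$ put an arc between $u^1$ and $v^2$ (corresponding to $a$), directed from $v^2$ to $u^1$ if $a \in M$ and from $u^1$ to $v^2$ otherwise. Call this digraph $\vec H(M)$. A node $u^1$ not covered by the arcs corresponding to $M$ is a source; a node $u^2$ not so covered is a sink. An alternating path is a simple path in $\vec H(M)$ starting at a source; an augmenting path is an alternating path ending at a sink. For an alternating path $P$, $A(P)$ is the set of arcs of $H$ corresponding to the arcs of $P$. An even alternating or augmenting path $P$ is feasible if $M \triangle A(P)$ is an even factor. An alternating forest for $M$ is a directed out-forest in $\vec H(M)$ whose roots are exactly all the source nodes and in which every path from a root to a leaf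 has an even number of arcs. It is feasible if every even alternating path and every augmenting path contained in it is feasible. A node of $\vec H(M)$ is $\mathcal{T}$-reachable if it belongs to the forest $\mathcal{T}$. -}

module Defs where

open import Data.Nat using (ℕ; zero; suc; _∸_; _≤_)
open import Data.Fin using (Fin; zero; suc; inject₁; fromℕ)
open import Data.Fin.Subset using (Subset; _∈_; _⊆_; ∣_∣; ⁅_⁆; _∪_) renaming (⊥ to ∅)
open import Data.Bool using (Bool; true; false; if_then_else_; _xor_)
open import Data.Vec using (lookup; zipWith)
open import Data.Sum using (_⊎_; inj₁; inj₂)
open import Data.Product using (Σ; ∃; _×_; _,_)
open import Data.List using (List; []; _∷_)
open import Data.List.Relation.Unary.Unique.Propositional using (Unique)
open import Relation.Binary.PropositionalEquality using (_≡_; _≢_)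
open import Relation.Nullary using (¬_)
open import Function.Definitions using (Injective)

data Even : ℕ → Set where
  even-zero : Even zero
  even-ss   : ∀ {n} → Even n → Even (suc (suc n))

-- Digraphs: finitely many nodes (Fin nodes) and arcs (Fin arcs);
-- parallel arcs are allowed, loops are not.

record Digraph : Set where
  field
    nodes  : ℕ
    arcs   : ℕ
    tail   : Fin arcs → Fin nodes
    head   : Fin arcs → Fin nodes
    noLoop : ∀ a → tail a ≢ head a

open Digraph public

ArcSet : Digraph → Set
ArcSet H = Subset (arcs H)

_△_ : ∀ {m} → Subset m → Subset m → Subset m
M △ A = zipWith _xor_ M A

-- M is a union of node-disjoint simple paths and simple cycles, i.e.
-- every node has at most one arc of M leaving it and at most one entering it.
IsPathCycleMatching : (H : Digraph) → ArcSet H → Set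
IsPathCycleMatching H M =
  (∀ a b → a ∈ M → b ∈ M → tail H a ≡ tail H b → a ≡ b) ×
  (∀ a b → a ∈ M → b ∈ M → head H a ≡ head H b → a ≡ b)

record Cycle (H : Digraph) : Set where
  field
    len    : ℕ
    arc    : Fin (suc len) → Fin (arcs H)
    chain  : ∀ (i : Fin len) → head H (arc (inject₁ i)) ≡ tail H (arc (suc i))
    close  : head H (arc (fromℕ len)) ≡ tail H (arc zero)
    simple : Injective _≡_ _≡_ (λ i → tail H (arc i))

open Cycle public

cycleLength : ∀ {H} → Cycle H → ℕ
cycleLength C = suc (len C)

CycleIn : (H : Digraph) → ArcSet H → Cycle H → Set
CycleIn H M C = ∀ i → arc C i ∈ M

IsEvenFactor : (H : Digraph) → ArcSet H → Set
IsEvenFactor H M =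
  IsPathCycleMatching H M ×
  (∀ (C : Cycle H) → CycleIn H M C → Even (cycleLength C))

defOf : (H : Digraph) → ArcSet H → ℕ
defOf H M = nodes H ∸ ∣ M ∣

IsDef : Digraph → ℕ → Set
IsDef H d =
  (Σ (ArcSet H) λ M → IsEvenFactor H M × defOf H M ≡ d) ×
  (∀ (M : ArcSet H) → IsEvenFactor H M → d ≤ defOf H M)

IsMaxEvenFactor : (H : Digraph) → ArcSet H → Set
IsMaxEvenFactor H N =
  IsEvenFactor H N × (∀ M → IsEvenFactor H M → ∣ M ∣ ≤ ∣ N ∣)

-- Γ * v : add a new node v' and the single arc (v, v').
-- New node is zero, old node u is suc u; new arc is zero, old arc a is suc a.

star-tail : (Γ : Digraph) → Fin (nodes Γ) → Fin (suc (arcs Γ)) → Fin (suc (nodes Γ))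
star-tail Γ v zero    = suc v
star-tail Γ v (suc a) = suc (tail Γ a)

star-head : (Γ : Digraph) → Fin (suc (arcs Γ)) → Fin (suc (nodes Γ))
star-head Γ zero    = zero
star-head Γ (suc a) = suc (head Γ a)

star-noLoop : (Γ : Digraph) (v : Fin (nodes Γ)) → ∀ a → star-tail Γ v a ≢ star-head Γ a
star-noLoop Γ v zero ()
star-noLoop Γ v (suc a) eq = noLoop Γ a (suc-inj eq)
  where
  suc-inj : ∀ {k} {x y : Fin k} → Fin.suc x ≡ suc y → x ≡ y
  suc-inj _≡_.refl = _≡_.refl

_*_ : (Γ : Digraph) → Fin (nodes Γ) → Digraph
Γ * v = record
  { nodes  = suc (nodes Γ)
  ; arcs   = suc (arcs Γ)
  ; tail   = star-tail Γ v
  ; head   = star-head Γ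
  ; noLoop = star-noLoop Γ v
  }

-- Auxiliary digraph H⃗(M): nodes inj₁ u = u¹, inj₂ u = u².
-- Arc of H⃗(M) corresponding to a = (u,v): from v² to u¹ if a ∈ M,
-- from u¹ to v² otherwise.

AuxNode : Digraph → Set
AuxNode H = Fin (nodes H) ⊎ Fin (nodes H)

auxSrc : (H : Digraph) → ArcSet H → Fin (arcs H) → AuxNode H
auxSrc H M a = if lookup M a then inj₂ (head H a) else inj₁ (tail H a)

auxTgt : (H : Digraph) → ArcSet H → Fin (arcs H) → AuxNode H
auxTgt H M a = if lookup M a then inj₁ (tail H a) else inj₂ (head H a)

IsSource : (H : Digraph) → ArcSet H → AuxNode H → Set
IsSource H M x = Σ (Fin (nodes H)) λ u → x ≡ inj₁ u × (∀ a → a ∈ M → tail H a ≢ u)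

IsSink : (H : Digraph) → ArcSet H → AuxNode H → Set
IsSink H M x = Σ (Fin (nodes H)) λ u → x ≡ inj₂ u × (∀ a → a ∈ M → head H a ≢ u)

data Walk (H : Digraph) (M : ArcSet H) : AuxNode H → AuxNode H → Set where
  []   : ∀ {x} → Walk H M x x
  step : ∀ {x y} (a : Fin (arcs H)) → auxSrc H M a ≡ x →
         Walk H M (auxTgt H M a) y → Walk H M x y

walkNodes : ∀ {H M x y} → Walk H M x y → List (AuxNode H)
walkNodes {x = x} []   = x ∷ []
walkNodes {x = x} (step a _ w) = x ∷ walkNodes w

walkLength : ∀ {H M x y} → Walk H M x y → ℕ
walkLength []           = zero
walkLength (step _ _ w) = suc (walkLength w)

arcSetOf : ∀ {H M x y} → Walk H M x y → ArcSet H
arcSetOf []           = ∅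
arcSetOf (step a _ w) = ⁅ a ⁆ ∪ arcSetOf w

IsSimple : ∀ {H M x y} → Walk H M x y → Set
IsSimple w = Unique (walkNodes w)

IsFeasiblePath : ∀ {H M x y} → Walk H M x y → Set
IsFeasiblePath {H} {M} w = IsEvenFactor H (M △ arcSetOf w)

-- Alternating forests: a subgraph of H⃗(M) given by a node set and an
-- arc set F (arcs of H, standing for the corresponding arcs of H⃗(M)).

record AlternatingForest (H : Digraph) (M : ArcSet H) : Set₁ where
  field
    inT  : AuxNode H → Set
    F    : ArcSet H
    arcEnds   : ∀ a → a ∈ F → inT (auxSrc H M a) × inT (auxTgt H M a)
    inDeg≤1   : ∀ a b → a ∈ F → b ∈ F → auxTgt H M a ≡ auxTgt H M b → a ≡ b
    sourceIn  : ∀ x → IsSource H M x → inT x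
    sourceRoot : ∀ x → IsSource H M x → ∀ a → a ∈ F → auxTgt H M a ≢ x
    rootSource : ∀ x → inT x → (∀ a → a ∈ F → auxTgt H M a ≢ x) → IsSource H M x
    reach     : ∀ y → inT y → Σ (AuxNode H) λ x → IsSource H M x ×
                  Σ (Walk H M x y) λ w → arcSetOf w ⊆ F
    evenLeaves : ∀ x y → IsSource H M x → inT y →
                  (∀ a → a ∈ F → auxSrc H M a ≢ y) →
                  (w : Walk H M x y) → arcSetOf w ⊆ F → Even (walkLength w)

open AlternatingForest public

-- feasible: every even alternating path and every augmenting path
-- contained in the forest is feasible
IsFeasibleForest : (H : Digraph) (M : ArcSet H) → AlternatingForest H M → Set
IsFeasibleForest H M T =
  ∀ x y → IsSource H M x → (w : Walk H M x y) → IsSimple w → arcSetOf w ⊆ F T →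
  (Even (walkLength w) ⊎ IsSink H M y) → IsFeasiblePath w

Reachable : ∀ {H M} → AlternatingForest H M → AuxNode H → Set
Reachable T x = inT T x

module Submission where

-- Let n = |VΓ| and d = def(Γ).  The deficiency of Γ * v is squeezed from both sides.
--
-- (≥) An even factor of Γ * v consists of an even factor R of Γ plus possibly the new
--     arc (v,v'), so its deficiency (n+1) - |R| - [new arc] is at least n - |R| ≥ d.
-- (≤) If N' is a maximum even factor of Γ in which no arc leaves v, then N' + (v,v')
--     is an even factor of Γ * v of deficiency n - |N'| = d.  Such an N' exists: if
--     some arc of N leaves v, then v¹ is not a source, so the forest contains a walk
--     from a source to v¹; erasing its loops gives a simple alternating path P between
--     level-1 nodes.  Then P is even, hence feasible, N △ A(P) is an even factor, it has
--     the size of N (P alternates between arcs outside and inside N), and the N-arc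
--     leaving v, being the last arc of P, has been toggled out.

open import Defs
open import Data.Nat using (ℕ)
open import Data.Fin using (Fin)
open import Data.Sum using (inj₁)

open import Data.Nat using (suc; _≤_)
open import Data.Nat.Properties using (≤-refl; ≤-trans; ≤-antisym; n≤1+n; ∸-monoʳ-≤)
import Data.Nat.Properties as ℕ
open import Data.Fin using (zero; suc; _≟_)
open import Data.Fin.Properties using (any?; suc-injective)
open import Data.Fin.Relation.Unary.Top using (view; ‵fromℕ; ‵inject₁)
open import Data.Fin.Subset using (Subset; _∈_; _∉_; _⊆_; ∣_∣; ⁅_⁆; _∪_) renaming (⊥ to ∅)
open import Data.Fin.Subset.Properties
  using (x∈p∪q⁺; x∈p∪q⁻; x∈⁅x⁆; x∈⁅y⁆⇒x≡y; ∉⊥; ∪-identityˡ; drop-there)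
  renaming (_∈?_ to _∈ˢ?_)
open import Data.Bool using (true; false; _xor_; if_then_else_)
open import Data.Bool.Properties using (xor-identityʳ)
open import Data.Vec using (_∷_; lookup; here; there)
open import Data.Vec.Properties using (lookup⇒[]=; zipWith-identityʳ)
open import Data.Sum using (_⊎_; inj₂; [_,_]′)
import Data.Sum as Sum
open import Data.Sum.Properties using (inj₁-injective) renaming (≡-dec to ⊎-≡-dec)
open import Data.Product using (Σ; _×_; _,_; proj₁; proj₂)
import Data.Product as Product
import Data.List.Membership.Propositional as List
open import Data.List.Relation.Unary.Any using (here; there)
import Data.List.Relation.Unary.All as All
open import Data.List.Relation.Unary.All.Properties using (¬Any⇒All¬)
open import Data.List.Relation.Unary.AllPairs using ([]; _∷_)
open import Function using (_∘_)
open import Relation.Binary.PropositionalEquality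
open import Relation.Binary.Definitions using (DecidableEquality)
open import Relation.Nullary using (yes; no; contradiction)
open import Relation.Nullary.Decidable using (_×-dec_)

△-identityʳ : ∀ {n} (X : Subset n) → X △ ∅ ≡ X
△-identityʳ = zipWith-identityʳ xor-identityʳ

△-⁅⁆∪ : ∀ {n} (X B : Subset n) (i : Fin n) → i ∉ B → X △ (⁅ i ⁆ ∪ B) ≡ (X △ ⁅ i ⁆) △ B
△-⁅⁆∪ (x ∷ X) (true  ∷ B) zero    i∉B = contradiction here i∉B
△-⁅⁆∪ (x ∷ X) (false ∷ B) zero    _   =
  cong₂ _∷_ (sym (xor-identityʳ _)) (cong₂ _△_ (sym (△-identityʳ X)) (∪-identityˡ B))
△-⁅⁆∪ (x ∷ X) (b ∷ B)     (suc i) i∉B =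
  cong₂ _∷_ (cong (_xor b) (sym (xor-identityʳ x))) (△-⁅⁆∪ X B i (i∉B ∘ there))

lookup-△⁅⁆ : ∀ {n} (X : Subset n) (i j : Fin n) → j ≢ i → lookup (X △ ⁅ i ⁆) j ≡ lookup X j
lookup-△⁅⁆ (x ∷ X) zero    zero    j≢i = contradiction refl j≢i
lookup-△⁅⁆ (x ∷ X) zero    (suc j) _   = cong (λ Y → lookup Y j) (△-identityʳ X)
lookup-△⁅⁆ (x ∷ X) (suc i) zero    _   = xor-identityʳ x
lookup-△⁅⁆ (x ∷ X) (suc i) (suc j) j≢i = lookup-△⁅⁆ X i j (j≢i ∘ cong suc)

∣△⁅⁆∣-insert : ∀ {n} (X : Subset n) i → lookup X i ≡ false → ∣ X △ ⁅ i ⁆ ∣ ≡ suc ∣ X ∣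
∣△⁅⁆∣-insert (false ∷ X) zero    _ = cong (suc ∘ ∣_∣) (△-identityʳ X)
∣△⁅⁆∣-insert (false ∷ X) (suc i) e = ∣△⁅⁆∣-insert X i e
∣△⁅⁆∣-insert (true  ∷ X) (suc i) e = cong suc (∣△⁅⁆∣-insert X i e)

∣△⁅⁆∣-remove : ∀ {n} (X : Subset n) i → lookup X i ≡ true → suc ∣ X △ ⁅ i ⁆ ∣ ≡ ∣ X ∣
∣△⁅⁆∣-remove (true  ∷ X) zero    _ = cong (suc ∘ ∣_∣) (△-identityʳ X)
∣△⁅⁆∣-remove (false ∷ X) (suc i) e = ∣△⁅⁆∣-remove X i e
∣△⁅⁆∣-remove (true  ∷ X) (suc i) e = cong suc (∣△⁅⁆∣-remove X i e)

∣△⁅⁆∣-exchange : ∀ {n} (X : Subset n) f g → f ≢ g → lookup X f ≡ false → lookup X g ≡ true →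
                 ∣ (X △ ⁅ f ⁆) △ ⁅ g ⁆ ∣ ≡ ∣ X ∣
∣△⁅⁆∣-exchange X f g f≢g f∉X g∈X = ℕ.suc-injective (begin
  suc ∣ (X △ ⁅ f ⁆) △ ⁅ g ⁆ ∣  ≡⟨ ∣△⁅⁆∣-remove (X △ ⁅ f ⁆) g g∈X△f ⟩
  ∣ X △ ⁅ f ⁆ ∣                ≡⟨ ∣△⁅⁆∣-insert X f f∉X ⟩
  suc ∣ X ∣                    ∎)
  where
  open ≡-Reasoning
  g∈X△f : lookup (X △ ⁅ f ⁆) g ≡ true
  g∈X△f = trans (lookup-△⁅⁆ X f g (f≢g ∘ sym)) g∈X

∈-△⁻ : ∀ {n} (X Y : Subset n) a → a ∈ X △ Y → (a ∈ X × a ∉ Y) ⊎ (a ∉ X × a ∈ Y)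
∈-△⁻ (true  ∷ X) (false ∷ Y) zero    here      = inj₁ (here , λ ())
∈-△⁻ (false ∷ X) (true  ∷ Y) zero    here      = inj₂ ((λ ()) , here)
∈-△⁻ (x ∷ X)     (y ∷ Y)     (suc a) (there m) =
  Sum.map (Product.map there (_∘ drop-there)) (Product.map (_∘ drop-there) there) (∈-△⁻ X Y a m)

∣∷∣≤1+ : ∀ {n} b (R : Subset n) → ∣ b ∷ R ∣ ≤ suc ∣ R ∣
∣∷∣≤1+ false R = n≤1+n _
∣∷∣≤1+ true  R = ≤-refl

AgreeOn : ∀ {n} → Subset n → Subset n → Subset n → Set
AgreeOn X Y A = ∀ a → a ∈ A → lookup X a ≡ lookup Y a

NoArcLeaves : (H : Digraph) → ArcSet H → Fin (nodes H) → Set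
NoArcLeaves H M v = ∀ a → a ∈ M → tail H a ≢ v

module AlternatingWalks {H : Digraph} {M : ArcSet H} where

  _≟ᴬ_ : DecidableEquality (AuxNode H)
  _≟ᴬ_ = ⊎-≡-dec _≟_ _≟_

  open import Data.List.Membership.DecPropositional _≟ᴬ_ using () renaming (_∈?_ to _∈ᴺ?_)

  data ArcView (a : Fin (arcs H)) : Set where
    unmatched : lookup M a ≡ false → auxSrc H M a ≡ inj₁ (tail H a) →
                auxTgt H M a ≡ inj₂ (head H a) → ArcView a
    matched   : lookup M a ≡ true  → auxSrc H M a ≡ inj₂ (head H a) →
                auxTgt H M a ≡ inj₁ (tail H a) → ArcView a

  arcView : ∀ a → ArcView a
  arcView a with lookup M a in eq
  ... | false = unmatched eq (cong (if_then inj₂ (head H a) else inj₁ (tail H a)) eq)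
                             (cong (if_then inj₁ (tail H a) else inj₂ (head H a)) eq)
  ... | true  = matched   eq (cong (if_then inj₂ (head H a) else inj₁ (tail H a)) eq)
                             (cong (if_then inj₁ (tail H a) else inj₂ (head H a)) eq)

  leave¹ : ∀ {a s} → auxSrc H M a ≡ inj₁ s → lookup M a ≡ false × auxTgt H M a ≡ inj₂ (head H a)
  leave¹ {a} p with arcView a
  ... | unmatched out _ tgt = out , tgt
  ... | matched _ src _     = contradiction (trans (sym src) p) λ ()

  leave² : ∀ {a s} → auxSrc H M a ≡ inj₂ s → lookup M a ≡ true × auxTgt H M a ≡ inj₁ (tail H a)
  leave² {a} p with arcView a
  ... | matched in' _ tgt = in' , tgt
  ... | unmatched _ src _ = contradiction (trans (sym src) p) λ ()

  enter¹ : ∀ {a t} → auxTgt H M a ≡ inj₁ t → lookup M a ≡ true × tail H a ≡ t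
  enter¹ {a} p with arcView a
  ... | matched in' _ tgt = in' , inj₁-injective (trans (sym tgt) p)
  ... | unmatched _ _ tgt = contradiction (trans (sym tgt) p) λ ()

  even-¹¹ : ∀ {x y s t} (w : Walk H M x y) → x ≡ inj₁ s → y ≡ inj₁ t → Even (walkLength w)
  even-¹¹ []                      _  _  = even-zero
  even-¹¹ (step f p [])           x¹ y¹ =
    contradiction (trans (sym (proj₂ (leave¹ (trans p x¹)))) y¹) λ ()
  even-¹¹ (step f p (step g q w)) x¹ y¹ =
    even-ss (even-¹¹ w (proj₂ (leave² (trans q (proj₂ (leave¹ (trans p x¹)))))) y¹)

  end∈nodes : ∀ {x y} (w : Walk H M x y) → y List.∈ walkNodes w
  end∈nodes []           = here refl
  end∈nodes (step _ _ w) = there (end∈nodes w)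

  src∈nodes : ∀ {x y} (w : Walk H M x y) {a} → a ∈ arcSetOf w → auxSrc H M a List.∈ walkNodes w
  src∈nodes []           m = contradiction m ∉⊥
  src∈nodes (step b p w) m with x∈p∪q⁻ ⁅ b ⁆ (arcSetOf w) m
  ... | inj₁ a∈b = here (trans (cong (auxSrc H M) (x∈⁅y⁆⇒x≡y b a∈b)) p)
  ... | inj₂ a∈w = there (src∈nodes w a∈w)

  src≢end : ∀ {x y} (w : Walk H M x y) → IsSimple w → ∀ {a} → a ∈ arcSetOf w → auxSrc H M a ≢ y
  src≢end []           _         m = contradiction m ∉⊥
  src≢end (step b p w) (x∉ ∷ sw) m with x∈p∪q⁻ ⁅ b ⁆ (arcSetOf w) m
  ... | inj₁ a∈b = λ src≡y →
    All.lookup x∉ (end∈nodes w)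
      (trans (sym p) (trans (cong (auxSrc H M) (sym (x∈⁅y⁆⇒x≡y b a∈b))) src≡y))
  ... | inj₂ a∈w = src≢end w sw a∈w

  entering-arc : ∀ {x y} (w : Walk H M x y) → x ≢ y →
                 Σ (Fin (arcs H)) λ a → a ∈ arcSetOf w × auxTgt H M a ≡ y
  entering-arc []                   x≢y = contradiction refl x≢y
  entering-arc {y = y} (step a p w) _   with auxTgt H M a ≟ᴬ y
  ... | yes tgt≡y = a , x∈p∪q⁺ (inj₁ (x∈⁅x⁆ a)) , tgt≡y
  ... | no  tgt≢y with entering-arc w tgt≢y
  ...   | b , b∈w , tgt≡y = b , x∈p∪q⁺ (inj₂ b∈w) , tgt≡y

  suffix : ∀ {x y z} (w : Walk H M x y) → z List.∈ walkNodes w →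
           Σ (Walk H M z y) λ w' → (IsSimple w → IsSimple w') × arcSetOf w' ⊆ arcSetOf w
  suffix []            (here refl) = [] , (λ sw → sw) , (λ m → m)
  suffix w@(step _ _ _) (here refl) = w , (λ sw → sw) , (λ m → m)
  suffix (step a p w)  (there z∈w) with suffix w z∈w
  ... | w' , simple' , sub = w' , (λ { (_ ∷ sw) → simple' sw }) , x∈p∪q⁺ ∘ inj₂ ∘ sub

  loop-erasure : ∀ {x y} (w : Walk H M x y) →
                 Σ (Walk H M x y) λ w' → IsSimple w' × arcSetOf w' ⊆ arcSetOf w
  loop-erasure []                 = [] , All.[] ∷ [] , λ m → m
  loop-erasure {x} (step a p w) with loop-erasure w
  ... | w₁ , simple₁ , sub₁ with x ∈ᴺ? walkNodes w₁
  ...   | yes x∈w₁ with suffix w₁ x∈w₁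
  ...     | w₂ , simple₂ , sub₂ = w₂ , simple₂ simple₁ , x∈p∪q⁺ ∘ inj₂ ∘ sub₁ ∘ sub₂
  loop-erasure {x} (step a p w) | w₁ , simple₁ , sub₁ | no x∉w₁ =
    step a p w₁ , ¬Any⇒All¬ _ x∉w₁ ∷ simple₁ , x∈p∪q⁺ ∘ Sum.map₂ sub₁ ∘ x∈p∪q⁻ ⁅ a ⁆ (arcSetOf w₁)

  -- Toggling a simple walk between level-1 nodes preserves the size of every arc set
  -- agreeing with M along the walk, because its arcs alternate outside and inside M.
  toggle-card : ∀ {x y s t} (w : Walk H M x y) → x ≡ inj₁ s → y ≡ inj₁ t → IsSimple w →
                (X : ArcSet H) → AgreeOn X M (arcSetOf w) → ∣ X △ arcSetOf w ∣ ≡ ∣ X ∣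
  toggle-card []                      _  _  _ X _ = cong ∣_∣ (△-identityʳ X)
  toggle-card (step f p [])           x¹ y¹ _ _ _ =
    contradiction (trans (sym (proj₂ (leave¹ (trans p x¹)))) y¹) λ ()
  toggle-card (step f p (step g q w)) x¹ y¹ (start-fresh ∷ mid-fresh ∷ sw) X agree = begin
    ∣ X △ (⁅ f ⁆ ∪ (⁅ g ⁆ ∪ A)) ∣   ≡⟨ cong ∣_∣ (△-⁅⁆∪ X (⁅ g ⁆ ∪ A) f f∉gA) ⟩
    ∣ (X △ ⁅ f ⁆) △ (⁅ g ⁆ ∪ A) ∣  ≡⟨ cong ∣_∣ (△-⁅⁆∪ (X △ ⁅ f ⁆) A g g∉A) ⟩
    ∣ X' △ A ∣                      ≡⟨ toggle-card w g-ends¹ y¹ sw X' agree' ⟩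
    ∣ X' ∣                          ≡⟨ ∣△⁅⁆∣-exchange X f g f≢g f∉X g∈X ⟩
    ∣ X ∣                           ∎
    where
    open ≡-Reasoning
    A X' : ArcSet H
    A  = arcSetOf w
    X' = (X △ ⁅ f ⁆) △ ⁅ g ⁆
    f-out : lookup M f ≡ false × auxTgt H M f ≡ inj₂ (head H f)
    f-out = leave¹ (trans p x¹)
    g-in : lookup M g ≡ true × auxTgt H M g ≡ inj₁ (tail H g)
    g-in = leave² (trans q (proj₂ f-out))
    g-ends¹ : auxTgt H M g ≡ inj₁ (tail H g)
    g-ends¹ = proj₂ g-in
    f∈w : f ∈ arcSetOf (step f p (step g q w))
    f∈w = x∈p∪q⁺ (inj₁ (x∈⁅x⁆ f))
    g∈w : g ∈ arcSetOf (step f p (step g q w))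
    g∈w = x∈p∪q⁺ (inj₂ (x∈p∪q⁺ (inj₁ (x∈⁅x⁆ g))))
    A⊆w : A ⊆ arcSetOf (step f p (step g q w))
    A⊆w = x∈p∪q⁺ ∘ inj₂ ∘ x∈p∪q⁺ ∘ inj₂
    f∉A : f ∉ A
    f∉A m = All.lookup start-fresh (there (src∈nodes w m)) (sym p)
    g∉A : g ∉ A
    g∉A m = All.lookup mid-fresh (src∈nodes w m) (sym q)
    f≢g : f ≢ g
    f≢g refl = contradiction (trans (sym (proj₁ f-out)) (proj₁ g-in)) λ ()
    f∉gA : f ∉ ⁅ g ⁆ ∪ A
    f∉gA m = [ f≢g ∘ x∈⁅y⁆⇒x≡y g , f∉A ]′ (x∈p∪q⁻ ⁅ g ⁆ A m)
    f∉X : lookup X f ≡ false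
    f∉X = trans (agree f f∈w) (proj₁ f-out)
    g∈X : lookup X g ≡ true
    g∈X = trans (agree g g∈w) (proj₁ g-in)
    agree' : AgreeOn X' M A
    agree' a a∈A = begin
      lookup X' a            ≡⟨ lookup-△⁅⁆ (X △ ⁅ f ⁆) g a (λ { refl → g∉A a∈A }) ⟩
      lookup (X △ ⁅ f ⁆) a   ≡⟨ lookup-△⁅⁆ X f a (λ { refl → f∉A a∈A }) ⟩
      lookup X a             ≡⟨ agree a (A⊆w a∈A) ⟩
      lookup M a             ∎

  -- Toggling a simple walk that ends at t¹ (and starts elsewhere) in a path-cycle
  -- matching leaves no arc leaving t: the M-arc leaving t is the walk's last arc.
  toggle-frees-end : IsPathCycleMatching H M → ∀ {x t} (w : Walk H M x (inj₁ t)) →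
                     x ≢ inj₁ t → IsSimple w → NoArcLeaves H (M △ arcSetOf w) t
  toggle-frees-end (tails-unique , _) w x≢t sw a a∈ tail≡t
    with ∈-△⁻ M (arcSetOf w) a a∈
  ... | inj₁ (a∈M , a∉w) with entering-arc w x≢t
  ...   | g , g∈w , g-enters with enter¹ g-enters
  ...     | g∈M , tail-g = a∉w (subst (_∈ arcSetOf w) (sym a≡g) g∈w)
    where
    a≡g : a ≡ g
    a≡g = tails-unique a g a∈M (lookup⇒[]= g M g∈M) (trans tail≡t (sym tail-g))
  toggle-frees-end _ w x≢t sw a a∈ tail≡t | inj₂ (a∉M , a∈w) with arcView a
  ... | matched a∈M _ _   = a∉M (lookup⇒[]= a M a∈M)
  ... | unmatched _ src _ = src≢end w sw a∈w (trans src (cong inj₁ tail≡t))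

next-arc : ∀ {H} (C : Cycle H) (i : Fin (suc (len C))) →
           Σ (Fin (suc (len C))) λ j → head H (arc C i) ≡ tail H (arc C j)
next-arc C i with view i
... | ‵fromℕ     = zero , close C
... | ‵inject₁ j = suc j , chain C j

module Extension (Γ : Digraph) (v : Fin (nodes Γ)) where

  liftCycle : Cycle Γ → Cycle (Γ * v)
  liftCycle C = record
    { len    = len C
    ; arc    = suc ∘ arc C
    ; chain  = cong suc ∘ chain C
    ; close  = cong suc (close C)
    ; simple = simple C ∘ suc-injective
    }

  restrict : ∀ b R → IsEvenFactor (Γ * v) (b ∷ R) → IsEvenFactor Γ R
  restrict b R ((tails , heads) , even) =
    ( (λ a c a∈ c∈ eq → suc-injective (tails (suc a) (suc c) (there a∈) (there c∈) (cong suc eq)))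
    , (λ a c a∈ c∈ eq → suc-injective (heads (suc a) (suc c) (there a∈) (there c∈) (cong suc eq))) )
    , λ C C⊆R → even (liftCycle C) (there ∘ C⊆R)

  tail-old : ∀ a → tail (Γ * v) a ≢ zero
  tail-old zero    ()
  tail-old (suc a) ()

  -- Hence the new arc, which enters v', lies on no cycle: its successor would leave v'.
  old-arc : (C : Cycle (Γ * v)) (i : Fin (suc (len C))) → Σ (Fin (arcs Γ)) λ a → arc C i ≡ suc a
  old-arc C i with arc C i in eq
  ... | suc a = a , refl
  ... | zero with next-arc C i
  ...   | j , head≡tail =
    contradiction (trans (sym head≡tail) (cong (head (Γ * v)) eq)) (tail-old (arc C j))

  lowerCycle : Cycle (Γ * v) → Cycle Γ
  lowerCycle C = record
    { len    = len C
    ; arc    = proj₁ ∘ old-arc C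
    ; chain  = λ i → suc-injective (trans (cong (head (Γ * v)) (sym (is-suc _)))
                                   (trans (chain C i) (cong (tail (Γ * v)) (is-suc _))))
    ; close  = suc-injective (trans (cong (head (Γ * v)) (sym (is-suc _)))
                              (trans (close C) (cong (tail (Γ * v)) (is-suc _))))
    ; simple = λ {i} {j} eq → simple C (trans (cong (tail (Γ * v)) (is-suc i))
                                       (trans (cong suc eq) (cong (tail (Γ * v)) (sym (is-suc j)))))
    }
    where
    is-suc : ∀ i → arc C i ≡ suc (proj₁ (old-arc C i))
    is-suc i = proj₂ (old-arc C i)

  lowerCycle-arc : ∀ C i → arc C i ≡ suc (arc (lowerCycle C) i)
  lowerCycle-arc C i = proj₂ (old-arc C i)

  extend : ∀ N' → IsEvenFactor Γ N' → NoArcLeaves Γ N' v → IsEvenFactor (Γ * v) (true ∷ N')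
  extend N' ((tails , heads) , even) v-free = (tails' , heads') , even'
    where
    tails' : ∀ a b → a ∈ true ∷ N' → b ∈ true ∷ N' → tail (Γ * v) a ≡ tail (Γ * v) b → a ≡ b
    tails' zero    zero    _  _  _  = refl
    tails' zero    (suc b) _  b∈ eq = contradiction (sym (suc-injective eq)) (v-free b (drop-there b∈))
    tails' (suc a) zero    a∈ _  eq = contradiction (suc-injective eq) (v-free a (drop-there a∈))
    tails' (suc a) (suc b) a∈ b∈ eq =
      cong suc (tails a b (drop-there a∈) (drop-there b∈) (suc-injective eq))
    heads' : ∀ a b → a ∈ true ∷ N' → b ∈ true ∷ N' → head (Γ * v) a ≡ head (Γ * v) b → a ≡ b
    heads' zero    zero    _  _  _  = refl
    heads' (suc a) (suc b) a∈ b∈ eq =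
      cong suc (heads a b (drop-there a∈) (drop-there b∈) (suc-injective eq))
    even' : ∀ C → CycleIn (Γ * v) (true ∷ N') C → Even (cycleLength C)
    even' C C⊆N' =
      even (lowerCycle C) (λ i → drop-there (subst (_∈ true ∷ N') (lowerCycle-arc C i) (C⊆N' i)))

maximum-attains-def : ∀ H N d → IsEvenFactor H N → (∀ M → IsEvenFactor H M → ∣ M ∣ ≤ ∣ N ∣) →
                      IsDef H d → defOf H N ≡ d
maximum-attains-def H N d efN maxN ((M , efM , defM≡d) , minimal) =
  ≤-antisym (subst (defOf H N ≤_) defM≡d (∸-monoʳ-≤ (nodes H) (maxN M efM))) (minimal N efN)

def-lower-bound : ∀ Γ v d → IsDef Γ d → ∀ M' → IsEvenFactor (Γ * v) M' → d ≤ defOf (Γ * v) M'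
def-lower-bound Γ v d (_ , minimal) (b ∷ R) ef =
  ≤-trans (minimal R (Extension.restrict Γ v b R ef)) (∸-monoʳ-≤ (suc (nodes Γ)) (∣∷∣≤1+ b R))

open AlternatingWalks using (loop-erasure; even-¹¹; toggle-card; toggle-frees-end)

avoiding-factor : (Γ : Digraph) (N : ArcSet Γ) → IsEvenFactor Γ N →
                  (T : AlternatingForest Γ N) → IsFeasibleForest Γ N T →
                  (v : Fin (nodes Γ)) → Reachable T (inj₁ v) →
                  Σ (ArcSet Γ) λ N' → IsEvenFactor Γ N' × ∣ N' ∣ ≡ ∣ N ∣ × NoArcLeaves Γ N' v
avoiding-factor Γ N efN T feasible v v¹∈T
  with any? (λ a → (a ∈ˢ? N) ×-dec (tail Γ a ≟ v))
... | no ¬leaving = N , efN , refl , λ a a∈N tail≡v → ¬leaving (a , a∈N , tail≡v)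
... | yes (e , e∈N , tail-e≡v) with reach T (inj₁ v) v¹∈T
...   | x , x-source@(u , x≡u¹ , u-free) , w , w⊆F with loop-erasure w
...     | P , simple , P⊆w =
  N △ arcSetOf P , feasible x (inj₁ v) x-source P simple (w⊆F ∘ P⊆w) (inj₁ (even-¹¹ P x≡u¹ refl))
                 , toggle-card P x≡u¹ refl simple N (λ _ _ → refl)
                 , toggle-frees-end (proj₁ efN) P x≢v¹ simple
  where
  -- the root u¹ is a source, whereas the arc e of N leaves v
  x≢v¹ : x ≢ inj₁ v
  x≢v¹ x≡v¹ = u-free e e∈N (trans tail-e≡v (inj₁-injective (trans (sym x≡v¹) x≡u¹)))

lemma4 : (Γ : Digraph) (N : ArcSet Γ) → IsMaxEvenFactor Γ N →
    (T : AlternatingForest Γ N) → IsFeasibleForest Γ N T →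
    (v : Fin (nodes Γ)) → Reachable T (inj₁ v) →
    ∀ (d : ℕ) → IsDef Γ d → IsDef (Γ * v) d
lemma4 Γ N (efN , maxN) T feasible v v¹∈T d def-Γ
  with avoiding-factor Γ N efN T feasible v v¹∈T
... | N' , efN' , ∣N'∣≡∣N∣ , v-free =
  (true ∷ N' , Extension.extend Γ v N' efN' v-free , def-N'≡d) , def-lower-bound Γ v d def-Γ
  where
  -- the deficiency of N' + (v,v') in Γ * v is that of N' in Γ
  def-N'≡d : defOf Γ N' ≡ d
  def-N'≡d = maximum-attains-def Γ N' d efN'
               (λ M efM → subst (∣ M ∣ ≤_) (sym ∣N'∣≡∣N∣) (maxN M efM)) def-Γ
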